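{- For all positive integers $n,k,\ell$ with $k\ge \ell$, we have $b_{n,k,\ell}\le \frac{k n^{k-1}}{\ell}$. Furthermore, if $k\ge \ell\ge 2$, then \[ c_{n,k,\ell}\le \frac{\binom{k}{2} n^{k-2}}{\binom{\ell}{2}}. \]
   Context: Let $H_{n,k}=\{0,1,\dots,n-1\}^k$. For $\ell\le k$, an $\ell$-rook is a point $P\in H_{n,k}$ together with a set $D$ of $\ell$ of the $k$ coordinate indices; it covers (attacks) $P$ itself and every point of $H_{n,k}$ which differs from $P$ in exactly one coordinate, that coordinate belonging to $D$. Distinct rooks must occupy distinct points. $b_{n,k,\ell}$ is the maximum number of $\ell$-rooks that can be placed in $H_{n,k}$ so that no rook attacks the position of another rook. $c_{n,k,\ell}$ is the maximum number of $\ell$-rooks that can be placed in $H_{n,k}$ so that no point of $H_{n,k}$ is covered by two different rooks. -}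

module Defs where

open import Data.Nat using (ℕ)
open import Data.Fin using (Fin)
open import Data.Fin.Subset using (Subset; _∈_; ∣_∣)
open import Data.Vec using (Vec; lookup)
open import Data.Product using (Σ; _×_; ∃)
open import Data.Sum using (_⊎_)
open import Relation.Binary.PropositionalEquality using (_≡_; _≢_)
open import Relation.Nullary using (¬_)

Point : ℕ → ℕ → Set
Point n k = Vec (Fin n) k

record Rook (n k ℓ : ℕ) : Set where
  constructor rook
  field
    pos  : Point n k
    dirs : Subset k
    size : ∣ dirs ∣ ≡ ℓ
open Rook public

DiffersExactlyIn : {n k : ℕ} → Subset k → Point n k → Point n k → Set
DiffersExactlyIn {n} {k} D P Q =
  Σ (Fin k) λ i → (i ∈ D) × (lookup P i ≢ lookup Q i)
                 × ((j : Fin k) → j ≢ i → lookup P j ≡ lookup Q j)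

Covers : {n k ℓ : ℕ} → Rook n k ℓ → Point n k → Set
Covers r Q = (pos r ≡ Q) ⊎ DiffersExactlyIn (dirs r) (pos r) Q

Placement : ℕ → ℕ → ℕ → ℕ → Set
Placement n k ℓ m = Fin m → Rook n k ℓ

DistinctPositions : {n k ℓ m : ℕ} → Placement n k ℓ m → Set
DistinctPositions {m = m} R = (i j : Fin m) → i ≢ j → pos (R i) ≢ pos (R j)

NonAttacking : {n k ℓ m : ℕ} → Placement n k ℓ m → Set
NonAttacking {m = m} R =
  DistinctPositions R × ((i j : Fin m) → i ≢ j → ¬ Covers (R i) (pos (R j)))

NonOverlapping : {n k ℓ m : ℕ} → Placement n k ℓ m → Set
NonOverlapping {n} {k} {m = m} R =
  DistinctPositions R
  × ((i j : Fin m) → i ≢ j → (Q : Point n k) → ¬ (Covers (R i) Q × Covers (R j) Q))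

-- Both bounds are double counts. For part one, send a rook at P and one of its directions i
-- to the pair (i, P with coordinate i deleted): if two rooks collide, their positions agree
-- off a direction of the first rook, so the first covers the second's position. For part two,
-- send a rook and an ordered pair i ≠ j of its directions to (i, j, P with coordinates i and j
-- deleted): if two rooks collide, moving P's coordinate i to Q's value gives a point covered by
-- both rooks. Hence mℓ ≤ k n^(k-1) and mℓ(ℓ-1) ≤ k(k-1) n^(k-2).
module Submission where

open import Defs
open import Data.Nat using (ℕ; suc; _+_; _*_; _∸_; _^_; _≤_; z≤n; s≤s)
open import Data.Nat.Properties using (*-comm; *-assoc; *-distribˡ-+; *-distribʳ-+; *-cancelˡ-≤; module ≤-Reasoning)
open import Data.Nat.Combinatorics using (_C_; nCk+nC[k+1]≡[n+1]C[k+1]; nC1≡n)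
open import Data.Fin using (Fin; zero; suc; punchIn; punchOut; funToFin; finToFun)
open import Data.Fin.Properties
  using (_≟_; injective⇒≤; *↔×; suc-injective; punchIn-injective; punchInᵢ≢i; punchIn-punchOut; punchOut-injective;
         finToFun-funToFin)
open import Data.Fin.Subset using (Subset; inside; outside; ∣_∣) renaming (_∈_ to _∈ₛ_)
open import Data.Vec using (tabulate; _∷_; lookup; removeAt; _[_]≔_; here; there)
open import Data.Vec.Properties using (tabulate∘lookup; tabulate-cong; removeAt-punchOut; lookup∘update; lookup∘update′)
open import Data.Product using (_×_; ∃; _,_)
open import Data.Product.Properties using (,-injective)
open import Data.Product.Function.NonDependent.Propositional using (_×-↔_)
open import Data.Sum using (inj₁; inj₂)
open import Data.Empty using (⊥-elim)
open import Relation.Nullary using (Dec; yes; no)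
open import Relation.Binary.PropositionalEquality
open import Function using (_∘_; Injective)
open import Function.Bundles using (Injection; _↣_; mk↣)
open import Function.Construct.Composition using (_↣-∘_)
open import Function.Properties.Inverse using (↔⇒↣; ↔-sym; ↔-refl)

private
  variable
    m l s t k n ℓ : ℕ

↣⇒≤ : Fin m ↣ Fin n → m ≤ n
↣⇒≤ f = injective⇒≤ (Injection.injective f)

×↣×⇒*≤ : (Fin m × Fin l) ↣ (Fin s × Fin t) → m * l ≤ s * t
×↣×⇒*≤ f = ↣⇒≤ (↔⇒↣ (↔-sym *↔×) ↣-∘ (f ↣-∘ ↔⇒↣ *↔×))

×₃↣×₃⇒*≤ : ∀ {l₁ l₂ t₁ t₂} → (Fin m × Fin l₁ × Fin l₂) ↣ (Fin s × Fin t₁ × Fin t₂) →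
           m * (l₁ * l₂) ≤ s * (t₁ * t₂)
×₃↣×₃⇒*≤ f = ×↣×⇒*≤ (↔⇒↣ (↔-refl ×-↔ ↔-sym *↔×) ↣-∘ (f ↣-∘ ↔⇒↣ (↔-refl ×-↔ *↔×)))

enumerate : (p : Subset k) → Fin ∣ p ∣ → Fin k
enumerate (inside ∷ p) zero = zero
enumerate (inside ∷ p) (suc x) = suc (enumerate p x)
enumerate (outside ∷ p) x = suc (enumerate p x)

enumerate-∈ : (p : Subset k) (x : Fin ∣ p ∣) → enumerate p x ∈ₛ p
enumerate-∈ (inside ∷ p) zero = here
enumerate-∈ (inside ∷ p) (suc x) = there (enumerate-∈ p x)
enumerate-∈ (outside ∷ p) x = there (enumerate-∈ p x)

enumerate-injective : (p : Subset k) → Injective _≡_ _≡_ (enumerate p)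
enumerate-injective (inside ∷ p) {zero} {zero} _ = refl
enumerate-injective (inside ∷ p) {suc x} {suc y} e = cong suc (enumerate-injective p (suc-injective e))
enumerate-injective (outside ∷ p) e = enumerate-injective p (suc-injective e)

direction : (r : Rook n k ℓ) → Fin ℓ → Fin k
direction (rook _ D refl) = enumerate D

direction-∈ : (r : Rook n k ℓ) (x : Fin ℓ) → direction r x ∈ₛ dirs r
direction-∈ (rook _ D refl) = enumerate-∈ D

direction-injective : (r : Rook n k ℓ) → Injective _≡_ _≡_ (direction r)
direction-injective (rook _ D refl) = enumerate-injective D

AgreeExcept : Fin k → Point n k → Point n k → Set
AgreeExcept i P Q = ∀ c → c ≢ i → lookup P c ≡ lookup Q c

AgreeExcept₂ : Fin k → Fin k → Point n k → Point n k → Set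
AgreeExcept₂ i j P Q = ∀ c → c ≢ i → c ≢ j → lookup P c ≡ lookup Q c

lookup-extensionality : {P Q : Point n k} → (∀ c → lookup P c ≡ lookup Q c) → P ≡ Q
lookup-extensionality {P = P} {Q} eq = begin
  P                   ≡⟨ tabulate∘lookup P ⟨
  tabulate (lookup P) ≡⟨ tabulate-cong eq ⟩
  tabulate (lookup Q) ≡⟨ tabulate∘lookup Q ⟩
  Q                   ∎
  where open ≡-Reasoning

agreeExcept⇒covers : (r : Rook n k ℓ) {i : Fin k} {Q : Point n k} →
                     i ∈ₛ dirs r → AgreeExcept i (pos r) Q → Covers r Q
agreeExcept⇒covers r {i} {Q} i∈D agree with lookup (pos r) i ≟ lookup Q i
... | no  differ = inj₂ (i , i∈D , differ , agree)
... | yes same   = inj₁ (lookup-extensionality λ c → sameAt c (c ≟ i))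
  where
  sameAt : ∀ c → Dec (c ≡ i) → lookup (pos r) c ≡ lookup Q c
  sameAt c (yes refl) = same
  sameAt c (no c≢i)   = agree c c≢i

agreeExcept₂⇒commonCover : (r s : Rook n k ℓ) {i j : Fin k} → i ≢ j → i ∈ₛ dirs r → j ∈ₛ dirs s →
                           AgreeExcept₂ i j (pos r) (pos s) → ∃ λ X → Covers r X × Covers s X
agreeExcept₂⇒commonCover r s {i} {j} i≢j i∈r j∈s agree =
  X , agreeExcept⇒covers r i∈r (λ c c≢i → sym (lookup∘update′ c≢i P (lookup Q i)))
    , agreeExcept⇒covers s j∈s (λ c c≢j → Q≡X-off-j c c≢j (c ≟ i))
  where
  P = pos r
  Q = pos s
  X = P [ i ]≔ lookup Q i
  Q≡X-off-j : ∀ c → c ≢ j → Dec (c ≡ i) → lookup Q c ≡ lookup X c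
  Q≡X-off-j c c≢j (yes refl) = sym (lookup∘update i P (lookup Q i))
  Q≡X-off-j c c≢j (no c≢i)   = trans (sym (agree c c≢i c≢j)) (sym (lookup∘update′ c≢i P (lookup Q i)))

funToFin-injective : {f g : Fin k → Fin n} → funToFin f ≡ funToFin g → ∀ x → f x ≡ g x
funToFin-injective {f = f} {g} e x = begin
  f x                     ≡⟨ finToFun-funToFin f x ⟨
  finToFun (funToFin f) x ≡⟨ cong (λ y → finToFun y x) e ⟩
  finToFun (funToFin g) x ≡⟨ finToFun-funToFin g x ⟩
  g x                     ∎
  where open ≡-Reasoning

residue : Point n (suc k) → Fin (suc k) → Fin (n ^ k)
residue P i = funToFin (lookup (removeAt P i))

residue-injective : {P Q : Point n (suc k)} {i : Fin (suc k)} → residue P i ≡ residue Q i → AgreeExcept i P Q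
residue-injective {P = P} {Q} {i} e c c≢i = begin
  lookup P c                           ≡⟨ removeAt-punchOut P i≢c ⟨
  lookup (removeAt P i) (punchOut i≢c) ≡⟨ funToFin-injective e (punchOut i≢c) ⟩
  lookup (removeAt Q i) (punchOut i≢c) ≡⟨ removeAt-punchOut Q i≢c ⟩
  lookup Q c                           ∎
  where
  open ≡-Reasoning
  i≢c = c≢i ∘ sym

agreeExcept-removeAt : {P Q : Point n (suc (suc k))} {i : Fin (suc (suc k))} {o : Fin (suc k)} →
                       AgreeExcept o (removeAt P i) (removeAt Q i) → AgreeExcept₂ i (punchIn i o) P Q
agreeExcept-removeAt {P = P} {Q} {i} {o} agree c c≢i c≢j = begin
  lookup P c                           ≡⟨ removeAt-punchOut P i≢c ⟨
  lookup (removeAt P i) (punchOut i≢c) ≡⟨ agree (punchOut i≢c) (c≢j ∘ punchOut≡o⇒c≡j) ⟩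
  lookup (removeAt Q i) (punchOut i≢c) ≡⟨ removeAt-punchOut Q i≢c ⟩
  lookup Q c                           ∎
  where
  open ≡-Reasoning
  i≢c = c≢i ∘ sym
  punchOut≡o⇒c≡j : punchOut i≢c ≡ o → c ≡ punchIn i o
  punchOut≡o⇒c≡j e = trans (sym (punchIn-punchOut i≢c)) (cong (punchIn i) e)

encode₁ : Point n (suc k) → Fin (suc k) → Fin (suc k) × Fin (n ^ k)
encode₁ P i = i , residue P i

encode₁-injective : {P Q : Point n (suc k)} {i j : Fin (suc k)} →
                    encode₁ P i ≡ encode₁ Q j → i ≡ j × AgreeExcept i P Q
encode₁-injective {P = P} {Q} e with ,-injective e
... | refl , same = refl , residue-injective {P = P} {Q} same

encode₂ : Point n (suc (suc k)) → (i j : Fin (suc (suc k))) → i ≢ j →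
          Fin (suc (suc k)) × Fin (suc k) × Fin (n ^ k)
encode₂ P i j i≢j = i , encode₁ (removeAt P i) (punchOut i≢j)

encode₂-injective : {P Q : Point n (suc (suc k))} {i j i′ j′ : Fin (suc (suc k))} {p : i ≢ j} {p′ : i′ ≢ j′} →
                    encode₂ P i j p ≡ encode₂ Q i′ j′ p′ → i ≡ i′ × j ≡ j′ × AgreeExcept₂ i j P Q
encode₂-injective {P = P} {Q} {i} {p = p} {p′} e with ,-injective e
... | refl , e′ with encode₁-injective {P = removeAt P i} {removeAt Q i} e′
... | o≡o′ , agree =
  refl , punchOut-injective p p′ o≡o′ ,
  subst (λ j → AgreeExcept₂ i j P Q) (punchIn-punchOut p) (agreeExcept-removeAt {P = P} {Q} agree)

covers⇒≡ : {R : Placement n k ℓ m} → NonAttacking R → {a b : Fin m} → Covers (R a) (pos (R b)) → a ≡ b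
covers⇒≡ (_ , noAttack) {a} {b} cov with a ≟ b
... | yes a≡b = a≡b
... | no  a≢b = ⊥-elim (noAttack a b a≢b cov)

commonCover⇒≡ : {R : Placement n k ℓ m} → NonOverlapping R → {a b : Fin m} →
                (∃ λ X → Covers (R a) X × Covers (R b) X) → a ≡ b
commonCover⇒≡ (_ , noOverlap) {a} {b} (X , cover) with a ≟ b
... | yes a≡b = a≡b
... | no  a≢b = ⊥-elim (noOverlap a b a≢b X cover)

rookDirection↣ : {R : Placement n (suc k) ℓ m} → NonAttacking R → (Fin m × Fin ℓ) ↣ (Fin (suc k) × Fin (n ^ k))
rookDirection↣ {ℓ = ℓ} {m = m} {R = R} nonAttacking = mk↣ injective
  where
  injective : Injective _≡_ _≡_ (λ ((a , d) : Fin m × Fin ℓ) → encode₁ (pos (R a)) (direction (R a) d))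
  injective {a , d} {b , d′} e with encode₁-injective {P = pos (R a)} {pos (R b)} e
  ... | sameDirection , agree with covers⇒≡ {R = R} nonAttacking (agreeExcept⇒covers (R a) (direction-∈ (R a) d) agree)
  ... | refl = cong (a ,_) (direction-injective (R a) sameDirection)

directions-≢ : (r : Rook n k (suc ℓ)) (d : Fin (suc ℓ)) (e : Fin ℓ) → direction r d ≢ direction r (punchIn d e)
directions-≢ r d e eq = punchInᵢ≢i d e (sym (direction-injective r eq))

rookDirectionPair↣ : {R : Placement n (suc (suc k)) (suc ℓ) m} → NonOverlapping R →
                     (Fin m × Fin (suc ℓ) × Fin ℓ) ↣ (Fin (suc (suc k)) × Fin (suc k) × Fin (n ^ k))
rookDirectionPair↣ {n = n} {k = k} {ℓ = ℓ} {m = m} {R = R} nonOverlapping = mk↣ injective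
  where
  encode : Fin m × Fin (suc ℓ) × Fin ℓ → Fin (suc (suc k)) × Fin (suc k) × Fin (n ^ k)
  encode (a , d , e) = encode₂ (pos (R a)) (direction (R a) d) (direction (R a) (punchIn d e)) (directions-≢ (R a) d e)
  injective : Injective _≡_ _≡_ encode
  injective {a , d , e} {b , d′ , e′} eq
    with encode₂-injective {P = pos (R a)} {pos (R b)} eq
  ... | sameFirst , sameSecond , agree
    with commonCover⇒≡ {R = R} nonOverlapping
           (agreeExcept₂⇒commonCover (R a) (R b) (directions-≢ (R a) d e) (direction-∈ (R a) d)
             (subst (_∈ₛ dirs (R b)) (sym sameSecond) (direction-∈ (R b) (punchIn d′ e′))) agree)
  ... | refl with direction-injective (R a) sameFirst
  ... | refl = cong (λ e → a , d , e) (punchIn-injective d e e′ (direction-injective (R a) sameSecond))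

nonAttacking-bound : {R : Placement n k ℓ m} → ℓ ≤ k → NonAttacking R → ℓ * m ≤ k * n ^ (k ∸ 1)
nonAttacking-bound {k = 0} z≤n _ = z≤n
nonAttacking-bound {n = n} {k = suc k} {ℓ = ℓ} {m = m} {R = R} _ nonAttacking =
  subst (_≤ suc k * n ^ k) (*-comm m ℓ) (×↣×⇒*≤ (rookDirection↣ {R = R} nonAttacking))

2*[1+n]C2≡[1+n]*n : ∀ n → 2 * (suc n C 2) ≡ suc n * n
2*[1+n]C2≡[1+n]*n 0 = refl
2*[1+n]C2≡[1+n]*n (suc n) = begin
  2 * (suc (suc n) C 2)       ≡⟨ cong (2 *_) (nCk+nC[k+1]≡[n+1]C[k+1] (suc n) 1) ⟨
  2 * (suc n C 1 + suc n C 2) ≡⟨ cong (λ c → 2 * (c + suc n C 2)) (nC1≡n (suc n)) ⟩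
  2 * (suc n + suc n C 2)     ≡⟨ *-distribˡ-+ 2 (suc n) (suc n C 2) ⟩
  2 * suc n + 2 * (suc n C 2) ≡⟨ cong (2 * suc n +_) (2*[1+n]C2≡[1+n]*n n) ⟩
  2 * suc n + suc n * n       ≡⟨ cong (2 * suc n +_) (*-comm (suc n) n) ⟩
  2 * suc n + n * suc n       ≡⟨ *-distribʳ-+ (suc n) 2 n ⟨
  suc (suc n) * suc n         ∎
  where open ≡-Reasoning

nonOverlapping-bound : {R : Placement n k ℓ m} → 2 ≤ ℓ → ℓ ≤ k → NonOverlapping R →
                       (ℓ C 2) * m ≤ (k C 2) * n ^ (k ∸ 2)
nonOverlapping-bound {n = n} {k = suc (suc k)} {ℓ = suc ℓ} {m = m} {R = R}
                     (s≤s (s≤s _)) (s≤s (s≤s _)) nonOverlapping =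
  *-cancelˡ-≤ 2 (begin
    2 * ((suc ℓ C 2) * m)             ≡⟨ *-assoc 2 (suc ℓ C 2) m ⟨
    2 * (suc ℓ C 2) * m               ≡⟨ cong (_* m) (2*[1+n]C2≡[1+n]*n ℓ) ⟩
    suc ℓ * ℓ * m                     ≡⟨ *-comm (suc ℓ * ℓ) m ⟩
    m * (suc ℓ * ℓ)                   ≤⟨ ×₃↣×₃⇒*≤ (rookDirectionPair↣ {R = R} nonOverlapping) ⟩
    suc (suc k) * (suc k * n ^ k)     ≡⟨ *-assoc (suc (suc k)) (suc k) (n ^ k) ⟨
    suc (suc k) * suc k * n ^ k       ≡⟨ cong (_* n ^ k) (2*[1+n]C2≡[1+n]*n (suc k)) ⟨
    2 * (suc (suc k) C 2) * n ^ k     ≡⟨ *-assoc 2 (suc (suc k) C 2) (n ^ k) ⟩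
    2 * ((suc (suc k) C 2) * n ^ k)   ∎)
  where open ≤-Reasoning

theorem3 : (n k ℓ : ℕ) → 1 ≤ n → 1 ≤ ℓ → ℓ ≤ k →
    ((m : ℕ) (R : Placement n k ℓ m) → NonAttacking R →
      ℓ * m ≤ k * n ^ (k ∸ 1))
    × (2 ≤ ℓ → (m : ℕ) (R : Placement n k ℓ m) → NonOverlapping R →
      (ℓ C 2) * m ≤ (k C 2) * n ^ (k ∸ 2))
theorem3 n k ℓ _ _ ℓ≤k =
  (λ m R → nonAttacking-bound {R = R} ℓ≤k) ,
  (λ 2≤ℓ m R → nonOverlapping-bound {R = R} 2≤ℓ ℓ≤k)
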